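{- Let $k\ge1$, let $I_k$ be a $k$-element chain and let $V$ be the $3$-element poset with elements $a,b,c$ and relations $a\prec c$, $b\prec c$ only. Then \[ \mathrm{Ehr}(\mathcal{O}(V\otimes I_k),x)=\frac{\sum_{i=0}^k\binom{k}{i}^2x^i}{(1-x)^{3k+1}}. \]
   Context: For a finite poset $(P,\preceq)$ on $[p]$, the order polytope $\mathcal{O}(P)\subset\mathbb{R}^p$ is defined by $0\le x_i\le 1$ and $x_i\le x_j$ whenever $i\prec j$. For an integral polytope $\mathcal{Q}\subset\mathbb{R}^p$, $\mathrm{ehr}(\mathcal{Q},n)=|n\mathcal{Q}\cap\mathbb{Z}^p|$ ($n\ge1$), and $\mathrm{Ehr}(\mathcal{Q},x)=1+\sum_{n\ge1}\mathrm{ehr}(\mathcal{Q},n)x^n$. The ordinal product $P_1\otimes P_2$ of posets is the poset on $\{(s,t):s\in P_1,t\in P_2\}$ with $(s,t)\preceq(s',t')$ iff either $s=s'$ and $t\preceq t'$ in $P_2$, or $s\prec s'$ in $P_1$. -}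

module Defs where

open import Data.Nat using (ℕ; zero; suc; _<ᵇ_; _≤ᵇ_; _*_; _+_; _∸_)
open import Data.Nat.Combinatorics using (_C_)
open import Data.Bool using (Bool; true; false; _∧_; _∨_; if_then_else_)
open import Data.Fin using (Fin; toℕ; remQuot)
import Data.Fin as Fin
open import Data.Fin.Properties using () renaming (_≟_ to _≟F_)
open import Data.Product using (_,_)
open import Data.List using (List; []; _∷_; map; concatMap; filter; length; allFin; upTo; foldr)
open import Data.Vec.Functional using (Vector) renaming (_∷_ to _◂_)
open import Data.Integer using (ℤ; +_; -_) renaming (_+_ to _+ℤ_; _*_ to _*ℤ_)
open import Data.Bool.Properties using () renaming (_≟_ to _≟B_)
open import Relation.Nullary.Decidable using (⌊_⌋)

-- A finite poset on [p] (represented as Fin p), given by its strict order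
-- relation as a Boolean-valued function: (i ≺ j) = true  iff  i ≺ j.
record FinPoset : Set where
  field
    size : ℕ
    _≺_  : Fin size → Fin size → Bool
open FinPoset public

chain : ℕ → FinPoset
chain k = record { size = k ; _≺_ = λ i j → toℕ i <ᵇ toℕ j }

-- The poset V on {a,b,c} = {0,1,2}: only a ≺ c and b ≺ c.
V : FinPoset
V = record { size = 3 ; _≺_ = rel }
  where
  rel : Fin 3 → Fin 3 → Bool
  rel Fin.zero          (Fin.suc (Fin.suc Fin.zero)) = true
  rel (Fin.suc Fin.zero) (Fin.suc (Fin.suc Fin.zero)) = true
  rel _ _ = false

-- Ordinal product P₁ ⊗ P₂ on Fin (|P₁| * |P₂|), element (s,t) encoded via
-- Data.Fin.combine / remQuot.  Strict order: (s,t) ≺ (s',t') iff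
-- (s = s' and t ≺ t' in P₂) or s ≺ s' in P₁.
_⊗_ : FinPoset → FinPoset → FinPoset
P₁ ⊗ P₂ = record { size = size P₁ * size P₂ ; _≺_ = rel }
  where
  rel : Fin (size P₁ * size P₂) → Fin (size P₁ * size P₂) → Bool
  rel u v with remQuot (size P₂) u | remQuot (size P₂) v
  ... | s , t | s' , t' = (⌊ s ≟F s' ⌋ ∧ (_≺_ P₂ t t')) ∨ (_≺_ P₁ s s')

boxPoints : (p n : ℕ) → List (Vector ℕ p)
boxPoints zero    n = (λ ()) ∷ []
boxPoints (suc p) n = concatMap (λ v → map (λ f → v ◂ f) (boxPoints p n)) (upTo (suc n))

respects : (P : FinPoset) → Vector ℕ (size P) → Bool
respects P x = foldr _∧_ true
  (concatMap (λ i → map (λ j → if _≺_ P i j then x i ≤ᵇ x j else true)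
                        (allFin (size P)))
             (allFin (size P)))

-- ehr(O(P), n) = |n O(P) ∩ ℤ^p|: integer points with 0 ≤ x_i ≤ n and
-- x_i ≤ x_j whenever i ≺ j.
ehrO : FinPoset → ℕ → ℕ
ehrO P n = length (filter (λ x → respects P x ≟B true) (boxPoints (size P) n))

-- Coefficients of Ehr(O(P), x) = 1 + Σ_{n≥1} ehr(O(P),n) x^n.
EhrCoeff : FinPoset → ℕ → ℕ
EhrCoeff P zero    = 1
EhrCoeff P (suc n) = ehrO P (suc n)

sumℤ : ℕ → (ℕ → ℤ) → ℤ
sumℤ zero    f = f 0
sumℤ (suc m) f = sumℤ m f +ℤ f (suc m)

sign : ℕ → ℤ
sign zero    = + 1
sign (suc j) = - sign j

-- Coefficient of x^m in the power series  (1-x)^e · Σ_n a_n x^n.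
mulOneMinusXPow : ℕ → (ℕ → ℕ) → ℕ → ℤ
mulOneMinusXPow e a m = sumℤ m (λ j → sign j *ℤ (+ (e C j) *ℤ + a (m ∸ j)))

-- Split a point of n·O(V ⊗ I_k) into its blocks of k coordinates over a, b and c.
-- Each block is a weakly increasing chain, and the chain over c starts above the tops
-- of the other two.  Conditioning on the first value t of the chain over c gives
--   ehr(n) = Σₜ C(k+t, k)² C(k-1+n-t, k-1),   i.e.   Ehr(x) = F(x) / (1-x)^k
-- with F(x) = Σₜ C(k+t, k)² xᵗ.  On coefficient sequences 1 - x acts as the backward
-- difference Δ, so it remains to show Δ^(2k+1) F = C(k, ·)²; this is the case k = l of
-- Σₜ C(k+t, k) C(l+t, l) xᵗ = Σᵢ C(k, i) C(l, i) xⁱ / (1-x)^(k+l+1), proved by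
-- induction on k and l from the Leibniz rule for Δ and Pascal's rule.
module Submission where

open import Defs
open import Data.Nat using (ℕ; _≤_; _*_; _+_)
open import Data.Nat.Combinatorics using (_C_)
open import Data.Integer using (+_)
open import Relation.Binary.PropositionalEquality using (_≡_)

import Data.Nat.Properties as ℕ
open import Algebra.Properties.CommutativeSemigroup ℕ.*-commutativeSemigroup using (x∙yz≈y∙xz)
open import Algebra.Properties.Semiring.Sum ℕ.+-*-semiring
  using (sum-syntax; sum-cong-≗; sum-replicate-zero; ∑-comm; *-distribʳ-sum)
open import Data.Bool using (Bool; true; false; T; if_then_else_; _∧_; _∨_)
open import Data.Bool.Properties
  using (if-cong; if-cong-then; if-eta; if-∧; T-∧; T-≡; ⇔→≡; ∧-identityʳ; ∨-identityʳ)
  renaming (_≟_ to _≟B_)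
open import Data.Fin using (Fin; toℕ; fromℕ; combine; remQuot) renaming (zero to fzero; suc to fsuc)
open import Data.Fin.Patterns using (0F; 1F; 2F)
open import Data.Fin.Properties using (toℕ≤pred[n]; remQuot-combine; combine-remQuot) renaming (_≟_ to _≟F_)
open import Data.Integer using (ℤ; -_; _-_) renaming (_+_ to _+ℤ_; _*_ to _*ℤ_)
import Data.Integer.Properties as ℤ
open import Data.Integer.Tactic.RingSolver using (solve-∀)
open import Data.List using (List; []; _∷_; _++_; length; filter; concatMap; applyUpTo; upTo; allFin; foldr)
import Data.List as List
import Data.List.Properties as List
open import Data.List.Membership.Propositional using (_∈_)
open import Data.List.Membership.Propositional.Properties using (∈-allFin)
open import Data.List.Relation.Unary.All using (All)
import Data.List.Relation.Unary.All as All
open import Data.List.Relation.Unary.All.Properties using (all⁺; all⁻; concat⁺; concat⁻; map⁺; map⁻)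
open import Data.Nat using (zero; suc; _<_; _∸_; _⊔_; _≤ᵇ_; _<ᵇ_; z≤n; s≤s)
open import Data.Nat.Combinatorics using (nCk+nC[k+1]≡[n+1]C[k+1])
open import Data.Nat.ListAction using (sum)
open import Data.Nat.ListAction.Properties using (sum-++)
open import Data.Nat.Tactic.RingSolver using () renaming (solve-∀ to solveℕ-∀)
open import Data.Product using (_×_; _,_; proj₁; proj₂)
open import Data.Unit using (tt)
open import Data.Vec.Functional using (Vector; head; tail; take; drop) renaming (_∷_ to _◂_)
open import Function using (_∘_; id; _⇔_; mk⇔; Equivalence)
import Function.Properties.Equivalence as ⇔
open import Relation.Nullary.Decidable using (⌊_⌋)
open import Relation.Binary.PropositionalEquality
  using (refl; sym; trans; cong; cong₂; subst; subst₂; _≗_; module ≡-Reasoning)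

open ≡-Reasoning

-- Power series and the backward difference

sumℤ-cong : ∀ m {f g : ℕ → ℤ} → (∀ j → j ≤ m → f j ≡ g j) → sumℤ m f ≡ sumℤ m g
sumℤ-cong zero    f≡g = f≡g 0 z≤n
sumℤ-cong (suc m) f≡g =
  cong₂ _+ℤ_ (sumℤ-cong m (λ j j≤m → f≡g j (ℕ.m≤n⇒m≤1+n j≤m))) (f≡g (suc m) ℕ.≤-refl)

sumℤ-zero : ∀ m {f : ℕ → ℤ} → (∀ j → j ≤ m → f j ≡ + 0) → sumℤ m f ≡ + 0
sumℤ-zero zero    f≡0 = f≡0 0 z≤n
sumℤ-zero (suc m) f≡0 =
  cong₂ _+ℤ_ (sumℤ-zero m (λ j j≤m → f≡0 j (ℕ.m≤n⇒m≤1+n j≤m))) (f≡0 (suc m) ℕ.≤-refl)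

sumℤ-unfoldˡ : ∀ m (f : ℕ → ℤ) → sumℤ (suc m) f ≡ f 0 +ℤ sumℤ m (f ∘ suc)
sumℤ-unfoldˡ zero    f = refl
sumℤ-unfoldˡ (suc m) f = begin
  sumℤ (suc m) f +ℤ f (suc (suc m))             ≡⟨ cong (_+ℤ f (suc (suc m))) (sumℤ-unfoldˡ m f) ⟩
  (f 0 +ℤ sumℤ m (f ∘ suc)) +ℤ f (suc (suc m))  ≡⟨ ℤ.+-assoc (f 0) _ _ ⟩
  f 0 +ℤ sumℤ (suc m) (f ∘ suc)                 ∎

sumℤ-distrib-− : ∀ m (f g : ℕ → ℤ) → sumℤ m (λ j → f j - g j) ≡ sumℤ m f - sumℤ m g
sumℤ-distrib-− zero    f g = refl
sumℤ-distrib-− (suc m) f g = begin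
  sumℤ m (λ j → f j - g j) +ℤ (f (suc m) - g (suc m))
    ≡⟨ cong (_+ℤ (f (suc m) - g (suc m))) (sumℤ-distrib-− m f g) ⟩
  (sumℤ m f - sumℤ m g) +ℤ (f (suc m) - g (suc m))
    ≡⟨ interchange (sumℤ m f) (sumℤ m g) (f (suc m)) (g (suc m)) ⟩
  sumℤ (suc m) f - sumℤ (suc m) g
    ∎
  where
  interchange : ∀ a b c d → (a - b) +ℤ (c - d) ≡ (a +ℤ c) - (b +ℤ d)
  interchange = solve-∀

-- Backward difference with the convention f (-1) = 0: on generating
-- functions it is multiplication by 1 - x.
Δ : (ℕ → ℤ) → ℕ → ℤ
Δ f zero    = f zero
Δ f (suc m) = f (suc m) - f m

Δ^ : ℕ → (ℕ → ℤ) → ℕ → ℤ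
Δ^ zero    f = f
Δ^ (suc e) f = Δ (Δ^ e f)

Δ-cong : ∀ {f g} → f ≗ g → Δ f ≗ Δ g
Δ-cong f≗g zero    = f≗g zero
Δ-cong f≗g (suc m) = cong₂ _-_ (f≗g (suc m)) (f≗g m)

Δ^-cong : ∀ e {f g} → f ≗ g → Δ^ e f ≗ Δ^ e g
Δ^-cong zero    f≗g = f≗g
Δ^-cong (suc e) f≗g = Δ-cong (Δ^-cong e f≗g)

Δ^-suc : ∀ e f → Δ^ (suc e) f ≗ Δ^ e (Δ f)
Δ^-suc zero    f = λ _ → refl
Δ^-suc (suc e) f = Δ-cong (Δ^-suc e f)

Δ^-+ : ∀ a b f → Δ^ (a + b) f ≗ Δ^ a (Δ^ b f)
Δ^-+ zero    b f = λ _ → refl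
Δ^-+ (suc a) b f = Δ-cong (Δ^-+ a b f)

Δ-homo-+ : ∀ f g → Δ (λ t → f t +ℤ g t) ≗ λ t → Δ f t +ℤ Δ g t
Δ-homo-+ f g zero    = refl
Δ-homo-+ f g (suc m) = interchange (f (suc m)) (g (suc m)) (f m) (g m)
  where
  interchange : ∀ a b c d → (a +ℤ b) - (c +ℤ d) ≡ (a - c) +ℤ (b - d)
  interchange = solve-∀

Δ-homo-− : ∀ f g → Δ (λ t → f t - g t) ≗ λ t → Δ f t - Δ g t
Δ-homo-− f g zero    = refl
Δ-homo-− f g (suc m) = interchange (f (suc m)) (g (suc m)) (f m) (g m)
  where
  interchange : ∀ a b c d → (a - b) - (c - d) ≡ (a - c) - (b - d)
  interchange = solve-∀

Δ^-homo-+ : ∀ e f g → Δ^ e (λ t → f t +ℤ g t) ≗ λ t → Δ^ e f t +ℤ Δ^ e g t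
Δ^-homo-+ zero    f g m = refl
Δ^-homo-+ (suc e) f g m = trans (Δ-cong (Δ^-homo-+ e f g) m) (Δ-homo-+ (Δ^ e f) (Δ^ e g) m)

Δ^-homo-− : ∀ e f g → Δ^ e (λ t → f t - g t) ≗ λ t → Δ^ e f t - Δ^ e g t
Δ^-homo-− zero    f g m = refl
Δ^-homo-− (suc e) f g m = trans (Δ-cong (Δ^-homo-− e f g) m) (Δ-homo-− (Δ^ e f) (Δ^ e g) m)

Δ-* : ∀ f g → Δ (λ t → f t *ℤ g t) ≗ λ t → (Δ f t *ℤ g t +ℤ f t *ℤ Δ g t) - Δ f t *ℤ Δ g t
Δ-* f g zero    = leibniz₀ (f 0) (g 0)
  where
  leibniz₀ : ∀ a b → a *ℤ b ≡ (a *ℤ b +ℤ a *ℤ b) - a *ℤ b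
  leibniz₀ = solve-∀
Δ-* f g (suc m) = leibniz (f (suc m)) (g (suc m)) (f m) (g m)
  where
  leibniz : ∀ a b c d → a *ℤ b - c *ℤ d ≡ ((a - c) *ℤ b +ℤ a *ℤ (b - d)) - (a - c) *ℤ (b - d)
  leibniz = solve-∀

pascalℤ : ∀ n j → + (suc n C suc j) ≡ + (n C j) +ℤ + (n C suc j)
pascalℤ n j = trans (cong +_ (sym (nCk+nC[k+1]≡[n+1]C[k+1] n j))) (ℤ.pos-+ (n C j) (n C suc j))

mulOneMinusXPow-zero : ∀ a → mulOneMinusXPow 0 a ≗ +_ ∘ a
mulOneMinusXPow-zero a zero    = trans (ℤ.*-identityˡ _) (ℤ.*-identityˡ (+ a 0))
mulOneMinusXPow-zero a (suc m) = begin
  mulOneMinusXPow 0 a (suc m)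
    ≡⟨ sumℤ-unfoldˡ m _ ⟩
  + 1 *ℤ (+ 1 *ℤ x) +ℤ sumℤ m (λ j → sign (suc j) *ℤ (+ (0 C suc j) *ℤ + a (m ∸ j)))
    ≡⟨ cong (+ 1 *ℤ (+ 1 *ℤ x) +ℤ_) (sumℤ-zero m (λ j _ → ℤ.*-zeroʳ (sign (suc j)))) ⟩
  + 1 *ℤ (+ 1 *ℤ x) +ℤ + 0
    ≡⟨ trans (ℤ.+-identityʳ _) (trans (ℤ.*-identityˡ _) (ℤ.*-identityˡ x)) ⟩
  x
    ∎
  where
  x : ℤ
  x = + a (suc m)

mulOneMinusXPow-suc : ∀ e a m →
  mulOneMinusXPow (suc e) a (suc m) ≡ mulOneMinusXPow e a (suc m) - mulOneMinusXPow e a m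
mulOneMinusXPow-suc e a m = begin
  mulOneMinusXPow (suc e) a (suc m)
    ≡⟨ sumℤ-unfoldˡ m _ ⟩
  lead +ℤ sumℤ m (term (suc e) ∘ suc)
    ≡⟨ cong (lead +ℤ_) (sumℤ-cong m (λ j _ → pascal j)) ⟩
  lead +ℤ sumℤ m (λ j → term e (suc j) - term′ j)
    ≡⟨ cong (lead +ℤ_) (sumℤ-distrib-− m (term e ∘ suc) term′) ⟩
  lead +ℤ (sumℤ m (term e ∘ suc) - mulOneMinusXPow e a m)
    ≡⟨ sym (ℤ.+-assoc lead (sumℤ m (term e ∘ suc)) _) ⟩
  (lead +ℤ sumℤ m (term e ∘ suc)) - mulOneMinusXPow e a m
    ≡⟨ cong (_- mulOneMinusXPow e a m) (sym (sumℤ-unfoldˡ m (term e))) ⟩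
  mulOneMinusXPow e a (suc m) - mulOneMinusXPow e a m
    ∎
  where
  term : ℕ → ℕ → ℤ
  term e′ j = sign j *ℤ (+ (e′ C j) *ℤ + a (suc m ∸ j))
  term′ : ℕ → ℤ
  term′ j = sign j *ℤ (+ (e C j) *ℤ + a (m ∸ j))
  lead : ℤ
  lead = term e 0
  split : ∀ s c c′ x → - s *ℤ ((c′ +ℤ c) *ℤ x) ≡ - s *ℤ (c *ℤ x) - s *ℤ (c′ *ℤ x)
  split = solve-∀
  pascal : ∀ j → term (suc e) (suc j) ≡ term e (suc j) - term′ j
  pascal j = trans (cong (λ c → - sign j *ℤ (c *ℤ + a (m ∸ j))) (pascalℤ e j))
                   (split (sign j) (+ (e C suc j)) (+ (e C j)) (+ a (m ∸ j)))

mulOneMinusXPow≗Δ^ : ∀ e a → mulOneMinusXPow e a ≗ Δ^ e (+_ ∘ a)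
mulOneMinusXPow≗Δ^ zero    a m       = mulOneMinusXPow-zero a m
mulOneMinusXPow≗Δ^ (suc e) a zero    = mulOneMinusXPow≗Δ^ e a zero
mulOneMinusXPow≗Δ^ (suc e) a (suc m) =
  trans (mulOneMinusXPow-suc e a m) (cong₂ _-_ (mulOneMinusXPow≗Δ^ e a (suc m)) (mulOneMinusXPow≗Δ^ e a m))

-- The Ehrhart functions of chains

-- ehrChain p t = C(p + t, p) = ehr(O(I_p), t) counts the chains 0 ≤ x₁ ≤ ⋯ ≤ x_p ≤ t.
ehrChain : ℕ → ℕ → ℕ
ehrChain zero    t       = 1
ehrChain (suc p) zero    = 1
ehrChain (suc p) (suc t) = ehrChain p (suc t) + ehrChain (suc p) t

ehrChain-zeroʳ : ∀ p → ehrChain p 0 ≡ 1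
ehrChain-zeroʳ zero    = refl
ehrChain-zeroʳ (suc p) = refl

ehrChainℤ : ℕ → ℕ → ℤ
ehrChainℤ p t = + ehrChain p t

δ : ℕ → ℤ
δ zero    = + 1
δ (suc _) = + 0

Δ-ehrChainℤ : ∀ p → Δ (ehrChainℤ (suc p)) ≗ ehrChainℤ p
Δ-ehrChainℤ p zero    = cong +_ (sym (ehrChain-zeroʳ p))
Δ-ehrChainℤ p (suc t) = begin
  + (ehrChain p (suc t) + ehrChain (suc p) t) - + ehrChain (suc p) t
    ≡⟨ cong (_- + ehrChain (suc p) t) (ℤ.pos-+ (ehrChain p (suc t)) _) ⟩
  (+ ehrChain p (suc t) +ℤ + ehrChain (suc p) t) - + ehrChain (suc p) t
    ≡⟨ cancel (+ ehrChain p (suc t)) (+ ehrChain (suc p) t) ⟩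
  + ehrChain p (suc t)
    ∎
  where
  cancel : ∀ a b → (a +ℤ b) - b ≡ a
  cancel = solve-∀

Δ^-ehrChainℤ : ∀ p → Δ^ (suc p) (ehrChainℤ p) ≗ δ
Δ^-ehrChainℤ zero    zero    = refl
Δ^-ehrChainℤ zero    (suc t) = refl
Δ^-ehrChainℤ (suc p) t = begin
  Δ^ (suc (suc p)) (ehrChainℤ (suc p)) t  ≡⟨ Δ^-suc (suc p) _ t ⟩
  Δ^ (suc p) (Δ (ehrChainℤ (suc p))) t    ≡⟨ Δ^-cong (suc p) (Δ-ehrChainℤ p) t ⟩
  Δ^ (suc p) (ehrChainℤ p) t              ≡⟨ Δ^-ehrChainℤ p t ⟩
  δ t                                     ∎

_⋆_ : (ℕ → ℤ) → (ℕ → ℤ) → ℕ → ℤ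
(D ⋆ F) n = sumℤ n (λ t → D t *ℤ F (n ∸ t))

⋆-congʳ : ∀ D {F G} → F ≗ G → D ⋆ F ≗ D ⋆ G
⋆-congʳ D F≗G n = sumℤ-cong n (λ t _ → cong (D t *ℤ_) (F≗G (n ∸ t)))

Δ-⋆ : ∀ D F → Δ (D ⋆ F) ≗ D ⋆ Δ F
Δ-⋆ D F zero    = refl
Δ-⋆ D F (suc n) = begin
  (sumℤ n (λ t → D t *ℤ F (suc n ∸ t)) +ℤ D (suc n) *ℤ F (n ∸ n)) - (D ⋆ F) n
    ≡⟨ reorder (sumℤ n (λ t → D t *ℤ F (suc n ∸ t))) (D (suc n) *ℤ F (n ∸ n)) ((D ⋆ F) n) ⟩
  (sumℤ n (λ t → D t *ℤ F (suc n ∸ t)) - (D ⋆ F) n) +ℤ D (suc n) *ℤ F (n ∸ n)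
    ≡⟨ cong₂ _+ℤ_ (sym (sumℤ-distrib-− n _ _)) (cong (λ i → D (suc n) *ℤ F i) (ℕ.n∸n≡0 n)) ⟩
  sumℤ n (λ t → D t *ℤ F (suc n ∸ t) - D t *ℤ F (n ∸ t)) +ℤ D (suc n) *ℤ F 0
    ≡⟨ cong₂ _+ℤ_ (sumℤ-cong n difference) (cong (λ i → D (suc n) *ℤ Δ F i) (sym (ℕ.n∸n≡0 n))) ⟩
  (D ⋆ Δ F) (suc n)
    ∎
  where
  reorder : ∀ a b c → (a +ℤ b) - c ≡ (a - c) +ℤ b
  reorder = solve-∀
  difference : ∀ t → t ≤ n → D t *ℤ F (suc n ∸ t) - D t *ℤ F (n ∸ t) ≡ D t *ℤ Δ F (suc n ∸ t)
  difference t t≤n rewrite ℕ.+-∸-assoc 1 t≤n = factor (D t) _ _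
    where
    factor : ∀ d x y → d *ℤ x - d *ℤ y ≡ d *ℤ (x - y)
    factor = solve-∀

Δ^-⋆ : ∀ e D F → Δ^ e (D ⋆ F) ≗ D ⋆ Δ^ e F
Δ^-⋆ zero    D F n = refl
Δ^-⋆ (suc e) D F n = trans (Δ-cong (Δ^-⋆ e D F) n) (Δ-⋆ D (Δ^ e F) n)

⋆-identityʳ : ∀ D → D ⋆ δ ≗ D
⋆-identityʳ D zero    = ℤ.*-identityʳ (D 0)
⋆-identityʳ D (suc n) = begin
  sumℤ n (λ t → D t *ℤ δ (suc n ∸ t)) +ℤ D (suc n) *ℤ δ (n ∸ n)
    ≡⟨ cong₂ _+ℤ_ (sumℤ-zero n vanish) (cong (λ i → D (suc n) *ℤ δ i) (ℕ.n∸n≡0 n)) ⟩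
  + 0 +ℤ D (suc n) *ℤ + 1
    ≡⟨ trans (ℤ.+-identityˡ _) (ℤ.*-identityʳ (D (suc n))) ⟩
  D (suc n)
    ∎
  where
  vanish : ∀ t → t ≤ n → D t *ℤ δ (suc n ∸ t) ≡ + 0
  vanish t t≤n rewrite ℕ.+-∸-assoc 1 t≤n = ℤ.*-zeroʳ (D t)

Δ^-⋆-ehrChainℤ : ∀ p D → Δ^ (suc p) (D ⋆ ehrChainℤ p) ≗ D
Δ^-⋆-ehrChainℤ p D n = begin
  Δ^ (suc p) (D ⋆ ehrChainℤ p) n   ≡⟨ Δ^-⋆ (suc p) D _ n ⟩
  (D ⋆ Δ^ (suc p) (ehrChainℤ p)) n ≡⟨ ⋆-congʳ D (Δ^-ehrChainℤ p) n ⟩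
  (D ⋆ δ) n                        ≡⟨ ⋆-identityʳ D n ⟩
  D n                              ∎

ehrChainProduct : ℕ → ℕ → ℕ → ℤ
ehrChainProduct k l t = ehrChainℤ k t *ℤ ehrChainℤ l t

binomialProduct : ℕ → ℕ → ℕ → ℤ
binomialProduct k l i = + (k C i) *ℤ + (l C i)

Δ-ehrChainProduct : ∀ k l → Δ (ehrChainProduct (suc k) (suc l)) ≗
  λ t → (ehrChainProduct k (suc l) t +ℤ ehrChainProduct (suc k) l t) - ehrChainProduct k l t
Δ-ehrChainProduct k l t =
  trans (Δ-* (ehrChainℤ (suc k)) (ehrChainℤ (suc l)) t)
        (cong₂ (λ a b → (a *ℤ ehrChainℤ (suc l) t +ℤ ehrChainℤ (suc k) t *ℤ b) - a *ℤ b)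
               (Δ-ehrChainℤ k t) (Δ-ehrChainℤ l t))

binomialProduct-pascal : ∀ k l i → binomialProduct (suc k) (suc l) i ≡
  (binomialProduct k (suc l) i +ℤ binomialProduct (suc k) l i) - Δ (binomialProduct k l) i
binomialProduct-pascal k l zero = refl
binomialProduct-pascal k l (suc i) = begin
  + (suc k C suc i) *ℤ + (suc l C suc i)
    ≡⟨ cong₂ _*ℤ_ (pascalℤ k i) (pascalℤ l i) ⟩
  (a′ +ℤ a) *ℤ (b′ +ℤ b)
    ≡⟨ expand a′ a b′ b ⟩
  (a *ℤ (b′ +ℤ b) +ℤ (a′ +ℤ a) *ℤ b) - (a *ℤ b - a′ *ℤ b′)
    ≡⟨ cong₂ (λ B A → (a *ℤ B +ℤ A *ℤ b) - (a *ℤ b - a′ *ℤ b′)) (sym (pascalℤ l i)) (sym (pascalℤ k i)) ⟩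
  (binomialProduct k (suc l) (suc i) +ℤ binomialProduct (suc k) l (suc i)) - Δ (binomialProduct k l) (suc i)
    ∎
  where
  a′ a b′ b : ℤ
  a′ = + (k C i)
  a  = + (k C suc i)
  b′ = + (l C i)
  b  = + (l C suc i)
  expand : ∀ a′ a b′ b →
    (a′ +ℤ a) *ℤ (b′ +ℤ b) ≡ (a *ℤ (b′ +ℤ b) +ℤ (a′ +ℤ a) *ℤ b) - (a *ℤ b - a′ *ℤ b′)
  expand = solve-∀

δ≗binomialProduct-zeroˡ : ∀ l → δ ≗ binomialProduct 0 l
δ≗binomialProduct-zeroˡ l zero    = refl
δ≗binomialProduct-zeroˡ l (suc i) = refl

δ≗binomialProduct-zeroʳ : ∀ k → δ ≗ binomialProduct k 0
δ≗binomialProduct-zeroʳ k zero    = refl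
δ≗binomialProduct-zeroʳ k (suc i) = sym (ℤ.*-zeroʳ (+ (k C suc i)))

Δ^-ehrChainProduct : ∀ k l → Δ^ (suc (k + l)) (ehrChainProduct k l) ≗ binomialProduct k l
Δ^-ehrChainProduct zero l i = begin
  Δ^ (suc l) (ehrChainProduct 0 l) i  ≡⟨ Δ^-cong (suc l) (λ t → ℤ.*-identityˡ (ehrChainℤ l t)) i ⟩
  Δ^ (suc l) (ehrChainℤ l) i          ≡⟨ Δ^-ehrChainℤ l i ⟩
  δ i                                 ≡⟨ δ≗binomialProduct-zeroˡ l i ⟩
  binomialProduct 0 l i               ∎
Δ^-ehrChainProduct (suc k) zero i = begin
  Δ^ (suc (suc k + 0)) (ehrChainProduct (suc k) 0) i
    ≡⟨ cong (λ e → Δ^ (suc e) (ehrChainProduct (suc k) 0) i) (ℕ.+-identityʳ (suc k)) ⟩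
  Δ^ (suc (suc k)) (ehrChainProduct (suc k) 0) i
    ≡⟨ Δ^-cong (suc (suc k)) (λ t → ℤ.*-identityʳ (ehrChainℤ (suc k) t)) i ⟩
  Δ^ (suc (suc k)) (ehrChainℤ (suc k)) i
    ≡⟨ Δ^-ehrChainℤ (suc k) i ⟩
  δ i
    ≡⟨ δ≗binomialProduct-zeroʳ (suc k) i ⟩
  binomialProduct (suc k) 0 i
    ∎
Δ^-ehrChainProduct (suc k) (suc l) i = begin
  Δ^ (suc e) (ehrChainProduct (suc k) (suc l)) i
    ≡⟨ Δ^-suc e _ i ⟩
  Δ^ e (Δ (ehrChainProduct (suc k) (suc l))) i
    ≡⟨ Δ^-cong e (Δ-ehrChainProduct k l) i ⟩
  Δ^ e (λ t → (ehrChainProduct k (suc l) t +ℤ ehrChainProduct (suc k) l t) - ehrChainProduct k l t) i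
    ≡⟨ Δ^-homo-− e _ _ i ⟩
  Δ^ e (λ t → ehrChainProduct k (suc l) t +ℤ ehrChainProduct (suc k) l t) i - Δ^ e (ehrChainProduct k l) i
    ≡⟨ cong (_- Δ^ e (ehrChainProduct k l) i) (Δ^-homo-+ e _ _ i) ⟩
  (Δ^ e (ehrChainProduct k (suc l)) i +ℤ Δ^ e (ehrChainProduct (suc k) l) i) - Δ^ e (ehrChainProduct k l) i
    ≡⟨ cong₂ _-_ (cong₂ _+ℤ_ (Δ^-ehrChainProduct k (suc l) i) lower-k) lower-both ⟩
  (binomialProduct k (suc l) i +ℤ binomialProduct (suc k) l i) - Δ (binomialProduct k l) i
    ≡⟨ sym (binomialProduct-pascal k l i) ⟩
  binomialProduct (suc k) (suc l) i
    ∎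
  where
  e : ℕ
  e = suc k + suc l
  e≡ : e ≡ suc (suc k + l)
  e≡ = ℕ.+-suc (suc k) l
  lower-k : Δ^ e (ehrChainProduct (suc k) l) i ≡ binomialProduct (suc k) l i
  lower-k = trans (cong (λ d → Δ^ d (ehrChainProduct (suc k) l) i) e≡) (Δ^-ehrChainProduct (suc k) l i)
  lower-both : Δ^ e (ehrChainProduct k l) i ≡ Δ (binomialProduct k l) i
  lower-both = Δ-cong (λ m → trans (cong (λ d → Δ^ d (ehrChainProduct k l) m) (ℕ.+-suc k l))
                                   (Δ^-ehrChainProduct k l m)) i

-- Sums over chains

≤ᵇ-suc : ∀ m n → (suc m ≤ᵇ suc n) ≡ (m ≤ᵇ n)
≤ᵇ-suc zero    n = refl
≤ᵇ-suc (suc m) n = refl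

≤ᵇ-⊔ : ∀ a b t → (a ⊔ b ≤ᵇ t) ≡ (a ≤ᵇ t) ∧ (b ≤ᵇ t)
≤ᵇ-⊔ zero    b       t       = refl
≤ᵇ-⊔ (suc a) zero    t       = sym (∧-identityʳ (suc a ≤ᵇ t))
≤ᵇ-⊔ (suc a) (suc b) zero    = refl
≤ᵇ-⊔ (suc a) (suc b) (suc t) =
  trans (≤ᵇ-suc (a ⊔ b) t) (trans (≤ᵇ-⊔ a b t) (sym (cong₂ _∧_ (≤ᵇ-suc a t) (≤ᵇ-suc b t))))

if-∧-as-product : ∀ x y N → (if x ∧ y then N else 0) ≡ (if y then 1 else 0) * ((if x then 1 else 0) * N)
if-∧-as-product true  true  N = sym (trans (ℕ.*-identityˡ (1 * N)) (ℕ.*-identityˡ N))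
if-∧-as-product true  false N = refl
if-∧-as-product false y     N = sym (ℕ.*-zeroʳ (if y then 1 else 0))

pos-∑ : ∀ n (f : ℕ → ℕ) → + (∑[ t < suc n ] f (toℕ t)) ≡ sumℤ n (+_ ∘ f)
pos-∑ zero    f = cong +_ (ℕ.+-identityʳ (f 0))
pos-∑ (suc n) f = begin
  + (f 0 + ∑[ t < suc n ] f (suc (toℕ t)))     ≡⟨ ℤ.pos-+ (f 0) _ ⟩
  + f 0 +ℤ + (∑[ t < suc n ] f (suc (toℕ t)))  ≡⟨ cong (+ f 0 +ℤ_) (pos-∑ n (f ∘ suc)) ⟩
  + f 0 +ℤ sumℤ n (+_ ∘ f ∘ suc)               ≡⟨ sym (sumℤ-unfoldˡ n (+_ ∘ f)) ⟩
  sumℤ (suc n) (+_ ∘ f)                        ∎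

chainsBetween : ℕ → ℕ → ℕ → ℕ
chainsBetween p lo t = if lo ≤ᵇ t then ehrChain p (t ∸ lo) else 0

chainsBetween-suc : ∀ p lo t → chainsBetween p (suc lo) (suc t) ≡ chainsBetween p lo t
chainsBetween-suc p lo t = if-cong (≤ᵇ-suc lo t)

hockeyStick : ∀ p {n} t → t ≤ n → ∑[ v < suc n ] chainsBetween p (toℕ v) t ≡ ehrChain (suc p) t
hockeyStick p {n} zero    _         = cong₂ _+_ (ehrChain-zeroʳ p) (sum-replicate-zero n)
hockeyStick p {suc n} (suc t) (s≤s t≤n) =
  cong (λ s → ehrChain p (suc t) + s)
       (trans (sum-cong-≗ {suc n} (λ v → chainsBetween-suc p (toℕ v) t)) (hockeyStick p t t≤n))

∑-chainsBetween : ∀ p {n} lo t → t ≤ n →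
  ∑[ v < suc n ] (if lo ≤ᵇ toℕ v then chainsBetween p (toℕ v) t else 0) ≡ chainsBetween (suc p) lo t
∑-chainsBetween p zero t t≤n = hockeyStick p t t≤n
∑-chainsBetween p {n} (suc lo) zero _ = trans (sum-cong-≗ vanish) (sum-replicate-zero (suc n))
  where
  vanish : ∀ (v : Fin (suc n)) → (if suc lo ≤ᵇ toℕ v then chainsBetween p (toℕ v) 0 else 0) ≡ 0
  vanish fzero    = refl
  vanish (fsuc v) = if-eta (suc lo ≤ᵇ suc (toℕ v))
∑-chainsBetween p {suc n} (suc lo) (suc t) (s≤s t≤n) = begin
  ∑[ v < suc n ] (if suc lo ≤ᵇ suc (toℕ v) then chainsBetween p (suc (toℕ v)) (suc t) else 0)
    ≡⟨ sum-cong-≗ {suc n} shift ⟩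
  ∑[ v < suc n ] (if lo ≤ᵇ toℕ v then chainsBetween p (toℕ v) t else 0)
    ≡⟨ ∑-chainsBetween p lo t t≤n ⟩
  chainsBetween (suc p) lo t
    ≡⟨ sym (chainsBetween-suc (suc p) lo t) ⟩
  chainsBetween (suc p) (suc lo) (suc t)
    ∎
  where
  shift : ∀ v → (if suc lo ≤ᵇ suc (toℕ v) then chainsBetween p (suc (toℕ v)) (suc t) else 0)
              ≡ (if lo ≤ᵇ toℕ v then chainsBetween p (toℕ v) t else 0)
  shift v = trans (if-cong (≤ᵇ-suc lo (toℕ v))) (if-cong-then (lo ≤ᵇ toℕ v) (chainsBetween-suc p (toℕ v) t))

-- sumIncreasing n p lo f = Σ f(x_p) over the chains lo ≤ x₁ ≤ ⋯ ≤ x_p ≤ n (just f lo when p = 0).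
sumIncreasing : (n p lo : ℕ) → (ℕ → ℕ) → ℕ
sumIncreasing n zero    lo f = f lo
sumIncreasing n (suc p) lo f = ∑[ v < suc n ] (if lo ≤ᵇ toℕ v then sumIncreasing n p (toℕ v) f else 0)

sumIncreasing-cong : ∀ {n} p {lo f g} → lo ≤ n → (∀ a → a ≤ n → f a ≡ g a) →
  sumIncreasing n p lo f ≡ sumIncreasing n p lo g
sumIncreasing-cong zero    lo≤n f≡g = f≡g _ lo≤n
sumIncreasing-cong {n} (suc p) {lo} _ f≡g =
  sum-cong-≗ {suc n} (λ v → if-cong-then (lo ≤ᵇ toℕ v) {y = 0} (sumIncreasing-cong p (toℕ≤pred[n] v) f≡g))

sumIncreasing-linear : ∀ n p lo {m} (F : Fin m → ℕ → ℕ) (w : Vector ℕ m) →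
  sumIncreasing n p lo (λ a → ∑[ t < m ] (F t a * w t)) ≡ ∑[ t < m ] (sumIncreasing n p lo (F t) * w t)
sumIncreasing-linear n zero    lo F w = refl
sumIncreasing-linear n (suc p) lo {m} F w = begin
  ∑[ v < suc n ] (if lo ≤ᵇ toℕ v then sumIncreasing n p (toℕ v) (λ a → ∑[ t < m ] (F t a * w t)) else 0)
    ≡⟨ sum-cong-≗ {suc n} pull ⟩
  ∑[ v < suc n ] ∑[ t < m ] term v t
    ≡⟨ ∑-comm term ⟩
  ∑[ t < m ] ∑[ v < suc n ] term v t
    ≡⟨ sum-cong-≗ {m} (λ t → sym (*-distribʳ-sum {suc n} (w t) (restricted t))) ⟩
  ∑[ t < m ] (sumIncreasing n (suc p) lo (F t) * w t)
    ∎
  where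
  restricted : Fin m → Fin (suc n) → ℕ
  restricted t v = if lo ≤ᵇ toℕ v then sumIncreasing n p (toℕ v) (F t) else 0
  term : Fin (suc n) → Fin m → ℕ
  term v t = restricted t v * w t
  pull : ∀ v → (if lo ≤ᵇ toℕ v then sumIncreasing n p (toℕ v) (λ a → ∑[ t < m ] (F t a * w t)) else 0)
             ≡ ∑[ t < m ] term v t
  pull v with lo ≤ᵇ toℕ v
  ... | true  = sumIncreasing-linear n p (toℕ v) F w
  ... | false = sym (sum-replicate-zero m)

atMost : ℕ → ℕ → ℕ
atMost t a = if a ≤ᵇ t then 1 else 0

sumIncreasing-atMost : ∀ {n} p lo t → t ≤ n → sumIncreasing n p lo (atMost t) ≡ chainsBetween p lo t
sumIncreasing-atMost zero    lo t _   = refl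
sumIncreasing-atMost {n} (suc p) lo t t≤n =
  trans (sum-cong-≗ {suc n} (λ v → if-cong-then (lo ≤ᵇ toℕ v) {y = 0} (sumIncreasing-atMost p (toℕ v) t t≤n)))
        (∑-chainsBetween p lo t t≤n)

sumIncreasing-one : ∀ {n} p lo → lo ≤ n → sumIncreasing n p lo (λ _ → 1) ≡ ehrChain p (n ∸ lo)
sumIncreasing-one {n} p lo lo≤n = begin
  sumIncreasing n p lo (λ _ → 1)   ≡⟨ sumIncreasing-cong p lo≤n (λ a a≤n → sym (if-cong (≤ᵇ-true a≤n))) ⟩
  sumIncreasing n p lo (atMost n)  ≡⟨ sumIncreasing-atMost p lo n ℕ.≤-refl ⟩
  chainsBetween p lo n             ≡⟨ if-cong (≤ᵇ-true lo≤n) ⟩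
  ehrChain p (n ∸ lo)              ∎
  where
  ≤ᵇ-true : ∀ {a} → a ≤ n → (a ≤ᵇ n) ≡ true
  ≤ᵇ-true = Equivalence.to T-≡ ∘ ℕ.≤⇒≤ᵇ

-- Lattice points of n·O(P)

boxSum : (p n : ℕ) → (Vector ℕ p → ℕ) → ℕ
boxSum p n w = sum (List.map w (boxPoints p n))

length-filter≡sum-if : ∀ {A : Set} (b : A → Bool) xs →
  length (filter (λ x → b x ≟B true) xs) ≡ sum (List.map (λ x → if b x then 1 else 0) xs)
length-filter≡sum-if b []       = refl
length-filter≡sum-if b (x ∷ xs) with b x
... | true  = cong suc (length-filter≡sum-if b xs)
... | false = length-filter≡sum-if b xs

ehrO≡boxSum : ∀ P n → ehrO P n ≡ boxSum (size P) n (λ x → if respects P x then 1 else 0)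
ehrO≡boxSum P n = length-filter≡sum-if (respects P) (boxPoints (size P) n)

sum-map-concatMap : ∀ {A B : Set} (w : B → ℕ) (F : A → List B) xs →
  sum (List.map w (concatMap F xs)) ≡ sum (List.map (λ x → sum (List.map w (F x))) xs)
sum-map-concatMap w F []       = refl
sum-map-concatMap w F (x ∷ xs) = begin
  sum (List.map w (F x ++ concatMap F xs))
    ≡⟨ cong sum (List.map-++ w (F x) _) ⟩
  sum (List.map w (F x) ++ List.map w (concatMap F xs))
    ≡⟨ sum-++ (List.map w (F x)) _ ⟩
  sum (List.map w (F x)) + sum (List.map w (concatMap F xs))
    ≡⟨ cong (λ s → sum (List.map w (F x)) + s) (sum-map-concatMap w F xs) ⟩
  sum (List.map w (F x)) + sum (List.map (λ x → sum (List.map w (F x))) xs)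
    ∎

sum-map-applyUpTo : ∀ (g f : ℕ → ℕ) m → sum (List.map g (applyUpTo f m)) ≡ ∑[ i < m ] g (f (toℕ i))
sum-map-applyUpTo g f zero    = refl
sum-map-applyUpTo g f (suc m) = cong (λ s → g (f 0) + s) (sum-map-applyUpTo g (f ∘ suc) m)

boxSum-suc : ∀ p n w → boxSum (suc p) n w ≡ ∑[ v < suc n ] boxSum p n (λ y → w (toℕ v ◂ y))
boxSum-suc p n w = begin
  boxSum (suc p) n w
    ≡⟨ sum-map-concatMap w (λ v → List.map (v ◂_) (boxPoints p n)) (upTo (suc n)) ⟩
  sum (List.map (λ v → sum (List.map w (List.map (v ◂_) (boxPoints p n)))) (upTo (suc n)))
    ≡⟨ cong sum (List.map-cong (λ v → cong sum (sym (List.map-∘ (boxPoints p n)))) (upTo (suc n))) ⟩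
  sum (List.map (λ v → boxSum p n (λ y → w (v ◂ y))) (upTo (suc n)))
    ≡⟨ sum-map-applyUpTo (λ v → boxSum p n (λ y → w (v ◂ y))) id (suc n) ⟩
  ∑[ v < suc n ] boxSum p n (λ y → w (toℕ v ◂ y))
    ∎

boxSum-zero : ∀ p n → boxSum p n (λ _ → 0) ≡ 0
boxSum-zero p n = sum-zeros (boxPoints p n)
  where
  sum-zeros : ∀ {A : Set} (xs : List A) → sum (List.map (λ _ → 0) xs) ≡ 0
  sum-zeros []       = refl
  sum-zeros (_ ∷ xs) = sum-zeros xs

boxSum-cong : ∀ p n {w w′} → w ≗ w′ → boxSum p n w ≡ boxSum p n w′
boxSum-cong p n w≗w′ = cong sum (List.map-cong w≗w′ (boxPoints p n))

increasingFrom : (p : ℕ) → ℕ → Vector ℕ p → Bool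
increasingFrom zero    lo y = true
increasingFrom (suc p) lo y = (lo ≤ᵇ head y) ∧ increasingFrom p (head y) (tail y)

lastFrom : (p : ℕ) → ℕ → Vector ℕ p → ℕ
lastFrom zero    lo y = lo
lastFrom (suc p) lo y = lastFrom p (head y) (tail y)

-- Weight of a point whose first p coordinates form a chain starting above lo; the
-- remaining coordinates are weighed by κ, which is told where that chain ended.
increasingThen : (p : ℕ) {r : ℕ} → ℕ → (ℕ → Vector ℕ r → ℕ) → Vector ℕ (p + r) → ℕ
increasingThen p lo κ x =
  if increasingFrom p lo (take p x) then κ (lastFrom p lo (take p x)) (drop p x) else 0

boxSum-increasingThen : ∀ p {r} n lo (κ : ℕ → Vector ℕ r → ℕ) →
  boxSum (p + r) n (increasingThen p lo κ) ≡ sumIncreasing n p lo (λ a → boxSum r n (κ a))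
boxSum-increasingThen zero    n lo κ = refl
boxSum-increasingThen (suc p) {r} n lo κ =
  trans (boxSum-suc (p + r) n (increasingThen (suc p) lo κ)) (sum-cong-≗ {suc n} peel)
  where
  peel : ∀ v → boxSum (p + r) n (λ y → if (lo ≤ᵇ toℕ v) ∧ increasingFrom p (toℕ v) (take p y)
                                      then κ (lastFrom p (toℕ v) (take p y)) (drop p y) else 0)
             ≡ (if lo ≤ᵇ toℕ v then sumIncreasing n p (toℕ v) (λ a → boxSum r n (κ a)) else 0)
  peel v with lo ≤ᵇ toℕ v
  ... | true  = boxSum-increasingThen p n (toℕ v) κ
  ... | false = boxSum-zero (p + r) n

increasingFrom-uncons : ∀ p lo y → T (increasingFrom (suc p) lo y) →
  lo ≤ head y × T (increasingFrom p (head y) (tail y))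
increasingFrom-uncons p lo y inc with Equivalence.to T-∧ inc
... | lo≤y₀ , inc′ = ℕ.≤ᵇ⇒≤ lo (head y) lo≤y₀ , inc′

increasingFrom⇒lower : ∀ p lo y → T (increasingFrom p lo y) → ∀ i → lo ≤ y i
increasingFrom⇒lower (suc p) lo y inc i with increasingFrom-uncons p lo y inc
increasingFrom⇒lower (suc p) lo y inc fzero    | lo≤y₀ , _    = lo≤y₀
increasingFrom⇒lower (suc p) lo y inc (fsuc i) | lo≤y₀ , inc′ =
  ℕ.≤-trans lo≤y₀ (increasingFrom⇒lower p (head y) (tail y) inc′ i)

increasingFrom⇒monotone : ∀ p lo y → T (increasingFrom p lo y) → ∀ i j → toℕ i < toℕ j → y i ≤ y j
increasingFrom⇒monotone (suc p) lo y inc i j i<j with increasingFrom-uncons p lo y inc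
increasingFrom⇒monotone (suc p) lo y inc fzero    (fsuc j) _         | _ , inc′ =
  increasingFrom⇒lower p (head y) (tail y) inc′ j
increasingFrom⇒monotone (suc p) lo y inc (fsuc i) (fsuc j) (s≤s i<j) | _ , inc′ =
  increasingFrom⇒monotone p (head y) (tail y) inc′ i j i<j

increasingFrom⇒≤lastFrom : ∀ p lo y → T (increasingFrom p lo y) → lo ≤ lastFrom p lo y
increasingFrom⇒≤lastFrom zero    lo y _ = ℕ.≤-refl
increasingFrom⇒≤lastFrom (suc p) lo y inc with increasingFrom-uncons p lo y inc
... | lo≤y₀ , inc′ = ℕ.≤-trans lo≤y₀ (increasingFrom⇒≤lastFrom p (head y) (tail y) inc′)

increasingFrom⇒upper : ∀ p lo y → T (increasingFrom p lo y) → ∀ i → y i ≤ lastFrom p lo y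
increasingFrom⇒upper (suc p) lo y inc i with increasingFrom-uncons p lo y inc
increasingFrom⇒upper (suc p) lo y inc fzero    | _ , inc′ = increasingFrom⇒≤lastFrom p (head y) (tail y) inc′
increasingFrom⇒upper (suc p) lo y inc (fsuc i) | _ , inc′ = increasingFrom⇒upper p (head y) (tail y) inc′ i

increasingFrom-intro : ∀ p lo y → (∀ i → lo ≤ y i) → (∀ i j → toℕ i < toℕ j → y i ≤ y j) →
  T (increasingFrom p lo y)
increasingFrom-intro zero    lo y _     _    = tt
increasingFrom-intro (suc p) lo y lower mono = Equivalence.from T-∧
  ( ℕ.≤⇒≤ᵇ (lower fzero)
  , increasingFrom-intro p (head y) (tail y)
      (λ i → mono fzero (fsuc i) (s≤s z≤n)) (λ i j i<j → mono (fsuc i) (fsuc j) (s≤s i<j)))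

lastFrom-suc : ∀ p lo y → lastFrom (suc p) lo y ≡ y (fromℕ p)
lastFrom-suc zero    lo y = refl
lastFrom-suc (suc p) lo y = lastFrom-suc p (head y) (tail y)

T-if-else-true : ∀ b {c} → T (if b then c else true) ⇔ (T b → T c)
T-if-else-true true  = mk⇔ (λ c _ → c) (λ c → c tt)
T-if-else-true false = mk⇔ (λ _ ()) (λ _ → tt)

T-and⁺ : ∀ bs → T (foldr _∧_ true bs) → All T bs
T-and⁺ bs = all⁺ id bs ∘ subst (T ∘ foldr _∧_ true) (sym (List.map-id bs))

T-and⁻ : ∀ {bs} → All T bs → T (foldr _∧_ true bs)
T-and⁻ {bs} = subst (T ∘ foldr _∧_ true) (List.map-id bs) ∘ all⁻ id

respects⇔ : ∀ P x → T (respects P x) ⇔ (∀ u v → T (_≺_ P u v) → x u ≤ x v)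
respects⇔ P x = mk⇔ sound complete
  where
  entry : Fin (size P) → Fin (size P) → Bool
  entry u v = if _≺_ P u v then x u ≤ᵇ x v else true
  sound : T (respects P x) → ∀ u v → T (_≺_ P u v) → x u ≤ x v
  sound r u v u≺v = ℕ.≤ᵇ⇒≤ (x u) (x v) (Equivalence.to (T-if-else-true (_≺_ P u v)) entry-uv u≺v)
    where
    rows : All (All T) (List.map (λ u → List.map (entry u) (allFin (size P))) (allFin (size P)))
    rows = concat⁻ (T-and⁺ (concatMap (λ u → List.map (entry u) (allFin (size P))) (allFin (size P))) r)
    entry-uv : T (entry u v)
    entry-uv = All.lookup (map⁻ {xs = allFin (size P)} (All.lookup (map⁻ {xs = allFin (size P)} rows) (∈-allFin u)))
                          (∈-allFin v)
  complete : (∀ u v → T (_≺_ P u v) → x u ≤ x v) → T (respects P x)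
  complete ordered = T-and⁻ (concat⁺ (map⁺ {xs = allFin (size P)} (All.tabulate row)))
    where
    row : ∀ {u} → u ∈ allFin (size P) → All T (List.map (entry u) (allFin (size P)))
    row {u} _ = map⁺ (All.tabulate λ {v} _ →
      Equivalence.from (T-if-else-true (_≺_ P u v)) (ℕ.≤⇒≤ᵇ ∘ ordered u v))

-- The poset V ⊗ I_k

ordinal≺ : ∀ {k} → Fin 3 → Fin k → Fin 3 → Fin k → Bool
ordinal≺ s t s′ t′ = (⌊ s ≟F s′ ⌋ ∧ (toℕ t <ᵇ toℕ t′)) ∨ _≺_ V s s′

≺-combine : ∀ {k} (s : Fin 3) (t : Fin k) s′ t′ →
  _≺_ (V ⊗ chain k) (combine s t) (combine s′ t′) ≡ ordinal≺ s t s′ t′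
≺-combine {k} s t s′ t′ = cong₂ (λ p q → ordinal≺ (proj₁ p) (proj₂ p) (proj₁ q) (proj₂ q))
                                (remQuot-combine {3} {k} s t) (remQuot-combine {3} {k} s′ t′)

module _ (k : ℕ) where

  block : Fin 3 → Vector ℕ (3 * k) → Vector ℕ k
  block s x = x ∘ combine s

  topOf : Fin 3 → Vector ℕ (3 * k) → ℕ
  topOf s x = lastFrom k 0 (block s x)

  chainsOfV : Vector ℕ (3 * k) → Bool
  chainsOfV x = increasingFrom k 0 (block 0F x)
              ∧ (increasingFrom k 0 (block 1F x) ∧ increasingFrom k (topOf 0F x ⊔ topOf 1F x) (block 2F x))

  BlockOrdered : Vector ℕ (3 * k) → Set
  BlockOrdered x =
    ∀ (s : Fin 3) (t : Fin k) s′ t′ → T (ordinal≺ s t s′ t′) → x (combine s t) ≤ x (combine s′ t′)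

  weightᶜ : ℕ → ℕ → Vector ℕ (k + 0) → ℕ
  weightᶜ a b = increasingThen k (a ⊔ b) (λ _ _ → 1)

  weightᵇᶜ : ℕ → Vector ℕ (k + (k + 0)) → ℕ
  weightᵇᶜ a = increasingThen k 0 (weightᶜ a)

  -- The indicator of chainsOfV, in the form that boxSum-increasingThen evaluates block by block.
  weight : Vector ℕ (3 * k) → ℕ
  weight = increasingThen k 0 weightᵇᶜ

  boxSum-weight : ∀ n → boxSum (3 * k) n weight
    ≡ sumIncreasing n k 0 (λ a → sumIncreasing n k 0 (λ b → sumIncreasing n k (a ⊔ b) (λ _ → 1)))
  boxSum-weight n =
    trans (boxSum-increasingThen k n 0 weightᵇᶜ)
          (sumIncreasing-cong k z≤n λ a _ →
            trans (boxSum-increasingThen k n 0 (weightᶜ a))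
                  (sumIncreasing-cong k z≤n λ b _ → boxSum-increasingThen k n (a ⊔ b) (λ _ _ → 1)))

module _ (k′ : ℕ) where
  private
    k : ℕ
    k = suc k′

  chainsOfV⇒blockOrdered : ∀ (x : Vector ℕ (3 * k)) → T (chainsOfV k x) → BlockOrdered k x
  chainsOfV⇒blockOrdered x chains = ordered
    where
    xᵃ xᵇ xᶜ : Vector ℕ k
    xᵃ = block k 0F x
    xᵇ = block k 1F x
    xᶜ = block k 2F x
    floorᶜ : ℕ
    floorᶜ = topOf k 0F x ⊔ topOf k 1F x
    incᵃ : T (increasingFrom k 0 xᵃ)
    incᵃ = proj₁ (Equivalence.to T-∧ chains)
    incᵇᶜ : T (increasingFrom k 0 xᵇ ∧ increasingFrom k floorᶜ xᶜ)
    incᵇᶜ = proj₂ (Equivalence.to (T-∧ {increasingFrom k 0 xᵃ}) chains)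
    incᵇ : T (increasingFrom k 0 xᵇ)
    incᵇ = proj₁ (Equivalence.to T-∧ incᵇᶜ)
    incᶜ : T (increasingFrom k floorᶜ xᶜ)
    incᶜ = proj₂ (Equivalence.to (T-∧ {increasingFrom k 0 xᵇ}) incᵇᶜ)
    within : ∀ {t t′ : Fin k} → T ((toℕ t <ᵇ toℕ t′) ∨ false) → toℕ t < toℕ t′
    within {t} {t′} r = ℕ.<ᵇ⇒< (toℕ t) (toℕ t′) (subst T (∨-identityʳ _) r)
    below-xᶜ : ∀ {a} → a ≤ floorᶜ → ∀ t′ → a ≤ xᶜ t′
    below-xᶜ a≤ t′ = ℕ.≤-trans a≤ (increasingFrom⇒lower k floorᶜ xᶜ incᶜ t′)
    ordered : BlockOrdered k x
    ordered 0F t 0F t′ r = increasingFrom⇒monotone k 0 xᵃ incᵃ t t′ (within r)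
    ordered 0F t 2F t′ _ = below-xᶜ (ℕ.≤-trans (increasingFrom⇒upper k 0 xᵃ incᵃ t) (ℕ.m≤m⊔n _ _)) t′
    ordered 1F t 1F t′ r = increasingFrom⇒monotone k 0 xᵇ incᵇ t t′ (within r)
    ordered 1F t 2F t′ _ = below-xᶜ (ℕ.≤-trans (increasingFrom⇒upper k 0 xᵇ incᵇ t) (ℕ.m≤n⊔m _ _)) t′
    ordered 2F t 2F t′ r = increasingFrom⇒monotone k floorᶜ xᶜ incᶜ t t′ (within r)
    ordered 0F t 1F t′ ()
    ordered 1F t 0F t′ ()
    ordered 2F t 0F t′ ()
    ordered 2F t 1F t′ ()

  blockOrdered⇒chainsOfV : ∀ (x : Vector ℕ (3 * k)) → BlockOrdered k x → T (chainsOfV k x)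
  blockOrdered⇒chainsOfV x ordered =
    Equivalence.from T-∧ (increasingBlock 0F , Equivalence.from T-∧ (increasingBlock 1F , increasingᶜ))
    where
    within : ∀ {t t′ : Fin k} → toℕ t < toℕ t′ → T ((toℕ t <ᵇ toℕ t′) ∨ false)
    within t<t′ = subst T (sym (∨-identityʳ _)) (ℕ.<⇒<ᵇ t<t′)
    monotone : ∀ s i j → toℕ i < toℕ j → block k s x i ≤ block k s x j
    monotone 0F i j i<j = ordered 0F i 0F j (within i<j)
    monotone 1F i j i<j = ordered 1F i 1F j (within i<j)
    monotone 2F i j i<j = ordered 2F i 2F j (within i<j)
    increasingBlock : ∀ s → T (increasingFrom k 0 (block k s x))
    increasingBlock s = increasingFrom-intro k 0 (block k s x) (λ _ → z≤n) (monotone s)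
    top≤ᶜ : ∀ s → (∀ i → T (ordinal≺ s (fromℕ k′) 2F i)) → ∀ i → topOf k s x ≤ block k 2F x i
    top≤ᶜ s s≺c i = subst (_≤ block k 2F x i) (sym (lastFrom-suc k′ 0 (block k s x)))
                          (ordered s (fromℕ k′) 2F i (s≺c i))
    increasingᶜ : T (increasingFrom k (topOf k 0F x ⊔ topOf k 1F x) (block k 2F x))
    increasingᶜ = increasingFrom-intro k _ (block k 2F x)
                    (λ i → ℕ.⊔-lub (top≤ᶜ 0F (λ _ → tt) i) (top≤ᶜ 1F (λ _ → tt) i)) (monotone 2F)

  respects-V⊗chain : ∀ x → respects (V ⊗ chain k) x ≡ chainsOfV k x
  respects-V⊗chain x = ⇔→≡ (⇔.trans (⇔.sym T-≡) (⇔.trans (mk⇔ to from) T-≡))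
    where
    to : T (respects (V ⊗ chain k) x) → T (chainsOfV k x)
    to r = blockOrdered⇒chainsOfV x λ s t s′ t′ s≺s′ →
      Equivalence.to (respects⇔ (V ⊗ chain k) x) r (combine s t) (combine s′ t′)
        (subst T (sym (≺-combine s t s′ t′)) s≺s′)
    from : T (chainsOfV k x) → T (respects (V ⊗ chain k) x)
    from c = Equivalence.from (respects⇔ (V ⊗ chain k) x) λ u v u≺v →
      let (s , t) = remQuot {3} k u; (s′ , t′) = remQuot {3} k v in
      subst₂ (λ u v → x u ≤ x v) (combine-remQuot {3} k u) (combine-remQuot {3} k v)
             (chainsOfV⇒blockOrdered x c s t s′ t′ u≺v)

  indicator-respects≡weight : ∀ x → (if respects (V ⊗ chain k) x then 1 else 0) ≡ weight k x
  indicator-respects≡weight x = begin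
    (if respects (V ⊗ chain k) x then 1 else 0)           ≡⟨ if-cong (respects-V⊗chain x) ⟩
    (if incᵃ ∧ (incᵇ ∧ incᶜ) then 1 else 0)               ≡⟨ if-∧ incᵃ ⟩
    (if incᵃ then (if incᵇ ∧ incᶜ then 1 else 0) else 0)  ≡⟨ if-cong-then incᵃ (if-∧ incᵇ) ⟩
    weight k x                                            ∎
    where
    incᵃ incᵇ incᶜ : Bool
    incᵃ = increasingFrom k 0 (block k 0F x)
    incᵇ = increasingFrom k 0 (block k 1F x)
    incᶜ = increasingFrom k (topOf k 0F x ⊔ topOf k 1F x) (block k 2F x)

  countChainsOfV : ∀ n →
    sumIncreasing n k 0 (λ a → sumIncreasing n k 0 (λ b → sumIncreasing n k (a ⊔ b) (λ _ → 1)))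
      ≡ ∑[ t < suc n ] (ehrChain k (toℕ t) * (ehrChain k (toℕ t) * ehrChain k′ (n ∸ toℕ t)))
  countChainsOfV n = begin
    sumIncreasing n k 0 (λ a → sumIncreasing n k 0 (λ b → sumIncreasing n k (a ⊔ b) (λ _ → 1)))
      ≡⟨ sumIncreasing-cong k z≤n (λ a _ → sumIncreasing-cong k z≤n (λ b _ → firstOfᶜ a b)) ⟩
    sumIncreasing n k 0 (λ a → sumIncreasing n k 0 (λ b → ∑[ t < suc n ] (atMost′ t b * (atMost′ t a * N t))))
      ≡⟨ sumIncreasing-cong k z≤n (λ a _ → sumIncreasing-linear n k 0 atMost′ (λ t → atMost′ t a * N t)) ⟩
    sumIncreasing n k 0 (λ a → ∑[ t < suc n ] (M t * (atMost′ t a * N t)))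
      ≡⟨ sumIncreasing-cong k z≤n (λ a _ → sum-cong-≗ {suc n} λ t → x∙yz≈y∙xz (M t) (atMost′ t a) (N t)) ⟩
    sumIncreasing n k 0 (λ a → ∑[ t < suc n ] (atMost′ t a * (M t * N t)))
      ≡⟨ sumIncreasing-linear n k 0 atMost′ (λ t → M t * N t) ⟩
    ∑[ t < suc n ] (M t * (M t * N t))
      ≡⟨ sum-cong-≗ {suc n} (λ t → cong₂ (λ m m′ → m * (m′ * N t)) (M≡ t) (M≡ t)) ⟩
    ∑[ t < suc n ] (ehrChain k (toℕ t) * (ehrChain k (toℕ t) * N t))
      ∎
    where
    atMost′ : Fin (suc n) → ℕ → ℕ
    atMost′ t = atMost (toℕ t)
    N : Fin (suc n) → ℕ
    N t = ehrChain k′ (n ∸ toℕ t)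
    M : Fin (suc n) → ℕ
    M t = sumIncreasing n k 0 (atMost′ t)
    M≡ : ∀ t → M t ≡ ehrChain k (toℕ t)
    M≡ t = sumIncreasing-atMost k 0 (toℕ t) (toℕ≤pred[n] t)
    firstOfᶜ : ∀ a b →
      sumIncreasing n k (a ⊔ b) (λ _ → 1) ≡ ∑[ t < suc n ] (atMost′ t b * (atMost′ t a * N t))
    firstOfᶜ a b = sum-cong-≗ {suc n} λ t →
      trans (if-cong-then (a ⊔ b ≤ᵇ toℕ t) {y = 0} (sumIncreasing-one k′ (toℕ t) (toℕ≤pred[n] t)))
            (trans (if-cong (≤ᵇ-⊔ a b (toℕ t))) (if-∧-as-product (a ≤ᵇ toℕ t) (b ≤ᵇ toℕ t) (N t)))

  ehrO-V⊗chain : ∀ n → + ehrO (V ⊗ chain k) n ≡ (ehrChainProduct k k ⋆ ehrChainℤ k′) n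
  ehrO-V⊗chain n = begin
    + ehrO (V ⊗ chain k) n
      ≡⟨ cong +_ count ⟩
    + (∑[ t < suc n ] (ehrChain k (toℕ t) * (ehrChain k (toℕ t) * ehrChain k′ (n ∸ toℕ t))))
      ≡⟨ pos-∑ n (λ t → ehrChain k t * (ehrChain k t * ehrChain k′ (n ∸ t))) ⟩
    sumℤ n (λ t → + (ehrChain k t * (ehrChain k t * ehrChain k′ (n ∸ t))))
      ≡⟨ sumℤ-cong n (λ t _ → pos-*-assoc (ehrChain k t) (ehrChain k t) (ehrChain k′ (n ∸ t))) ⟩
    (ehrChainProduct k k ⋆ ehrChainℤ k′) n
      ∎
    where
    pos-*-assoc : ∀ a b c → + (a * (b * c)) ≡ (+ a *ℤ + b) *ℤ + c
    pos-*-assoc a b c = trans (ℤ.pos-* a (b * c))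
                              (trans (cong (+ a *ℤ_) (ℤ.pos-* b c)) (sym (ℤ.*-assoc (+ a) (+ b) (+ c))))
    count : ehrO (V ⊗ chain k) n
          ≡ ∑[ t < suc n ] (ehrChain k (toℕ t) * (ehrChain k (toℕ t) * ehrChain k′ (n ∸ toℕ t)))
    count = begin
      ehrO (V ⊗ chain k) n
        ≡⟨ ehrO≡boxSum (V ⊗ chain k) n ⟩
      boxSum (3 * k) n (λ x → if respects (V ⊗ chain k) x then 1 else 0)
        ≡⟨ boxSum-cong (3 * k) n indicator-respects≡weight ⟩
      boxSum (3 * k) n (weight k)
        ≡⟨ boxSum-weight k n ⟩
      sumIncreasing n k 0 (λ a → sumIncreasing n k 0 (λ b → sumIncreasing n k (a ⊔ b) (λ _ → 1)))
        ≡⟨ countChainsOfV n ⟩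
      ∑[ t < suc n ] (ehrChain k (toℕ t) * (ehrChain k (toℕ t) * ehrChain k′ (n ∸ toℕ t)))
        ∎

  EhrCoeff-V⊗chain : +_ ∘ EhrCoeff (V ⊗ chain k) ≗ ehrChainProduct k k ⋆ ehrChainℤ k′
  EhrCoeff-V⊗chain zero    = cong (λ e → + 1 *ℤ + e) (sym (ehrChain-zeroʳ k′))
  EhrCoeff-V⊗chain (suc n) = ehrO-V⊗chain (suc n)

3*k+1≡1+[k+k]+k : ∀ k → 3 * k + 1 ≡ suc (k + k) + k
3*k+1≡1+[k+k]+k = solveℕ-∀

proposition3p4 : (k : ℕ) → 1 ≤ k → (m : ℕ) →
    mulOneMinusXPow (3 * k + 1) (EhrCoeff (V ⊗ chain k)) m ≡ + ((k C m) * (k C m))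
proposition3p4 (suc k′) _ m = begin
  mulOneMinusXPow (3 * k + 1) (EhrCoeff (V ⊗ chain k)) m  ≡⟨ mulOneMinusXPow≗Δ^ (3 * k + 1) _ m ⟩
  Δ^ (3 * k + 1) (+_ ∘ EhrCoeff (V ⊗ chain k)) m          ≡⟨ Δ^-cong (3 * k + 1) (EhrCoeff-V⊗chain k′) m ⟩
  Δ^ (3 * k + 1) series m                                 ≡⟨ cong (λ e → Δ^ e series m) (3*k+1≡1+[k+k]+k k) ⟩
  Δ^ (suc (k + k) + k) series m                           ≡⟨ Δ^-+ (suc (k + k)) k series m ⟩
  Δ^ (suc (k + k)) (Δ^ k series) m                        ≡⟨ Δ^-cong (suc (k + k)) (Δ^-⋆-ehrChainℤ k′ _) m ⟩
  Δ^ (suc (k + k)) (ehrChainProduct k k) m                ≡⟨ Δ^-ehrChainProduct k k m ⟩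
  + (k C m) *ℤ + (k C m)                                  ≡⟨ sym (ℤ.pos-* (k C m) (k C m)) ⟩
  + ((k C m) * (k C m))                                   ∎
  where
  k : ℕ
  k = suc k′
  series : ℕ → ℤ
  series = ehrChainProduct k k ⋆ ehrChainℤ k′
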